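{- Let $n,j\in\mathbb{Z}^+$, and let $G$ be a $j$-regular simple graph. If $n \nmid j$, then $\chi_{(n)}(G) = \chi(G)$.
   Context: A $\mathbb{Z}$-labeling of $G=(V,E)$ is a map $\ell:V\to\mathbb{Z}$; its order is the size of its range; it is proper if adjacent vertices get different labels; $\chi(G)$ is the minimum order of a proper labeling. $N(v)$ is the open neighborhood of $v$ (its neighbors, excluding $v$). An open coloring with nonzero remainders mod $n$ is a labeling with $\sum_{w\in N(v)}\ell(w)\not\equiv 0 \pmod n$ for all $v\in V$. If no proper such coloring exists, $\chi_{(n)}(G)$ does not exist; if proper such colorings of finite order exist, $\chi_{(n)}(G)$ is the minimum order of one; if they exist only of infinite order, $\chi_{(n)}(G)=\infty$. -}

module Defs where

open import Data.Nat using (ℕ; _<_)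
open import Data.Integer using (ℤ; +_; _+_)
open import Data.Integer.Divisibility using (_∣_)
open import Data.Fin using (Fin)
open import Data.List using (List; []; _∷_; length; map)
open import Data.List.Membership.Propositional using (_∈_)
open import Data.List.Relation.Unary.Unique.Propositional using (Unique)
open import Data.List.Relation.Unary.All using (All)
open import Data.Product using (Σ; ∃; _×_)
open import Relation.Nullary using (¬_)
open import Relation.Binary.PropositionalEquality using (_≡_; _≢_)
open import Function.Definitions using (Injective)
open import Function.Bundles using (_⇔_)

sumℤ : List ℤ → ℤ
sumℤ [] = + 0
sumℤ (x ∷ xs) = x + sumℤ xs

-- A simple graph on an arbitrary vertex type V (possibly infinite), given
-- together with a duplicate-free enumeration of each (open) neighbourhood.  Such graphs are exactly the locally
-- finite simple graphs, which includes all j-regular ones.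
record Graph : Set₁ where
  field
    V      : Set
    nbrs   : V → List V
    unique : ∀ v → Unique (nbrs v)
    sym    : ∀ {u v} → v ∈ nbrs u → u ∈ nbrs v
    irrefl : ∀ {v} → ¬ (v ∈ nbrs v)

  Adj : V → V → Set
  Adj u v = v ∈ nbrs u

open Graph public

Regular : ℕ → Graph → Set
Regular j G = ∀ v → length (nbrs G v) ≡ j

Labeling : Graph → Set
Labeling G = V G → ℤ

-- The labeling ℓ has order k: its range has exactly k elements, i.e. it is in
-- bijection with Fin k via an injective enumeration f.
HasOrder : (G : Graph) → Labeling G → ℕ → Set
HasOrder G ℓ k =
  Σ (Fin k → ℤ) λ f →
    Injective _≡_ _≡_ f
    × (∀ v → ∃ λ i → ℓ v ≡ f i)
    × (∀ i → ∃ λ v → ℓ v ≡ f i)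

Proper : (G : Graph) → Labeling G → Set
Proper G ℓ = ∀ u v → Adj G u v → ℓ u ≢ ℓ v

OpenNZ : ℕ → (G : Graph) → Labeling G → Set
OpenNZ n G ℓ = ∀ v → ¬ ((+ n) ∣ sumℤ (map ℓ (nbrs G v)))

IsChi : Graph → ℕ → Set
IsChi G k =
  (∃ λ ℓ → Proper G ℓ × HasOrder G ℓ k)
  × (∀ m → m < k → ∀ ℓ → Proper G ℓ → ¬ HasOrder G ℓ m)

IsChiN : ℕ → Graph → ℕ → Set
IsChiN n G k =
  (∃ λ ℓ → Proper G ℓ × OpenNZ n G ℓ × HasOrder G ℓ k)
  × (∀ m → m < k → ∀ ℓ → Proper G ℓ → OpenNZ n G ℓ → ¬ HasOrder G ℓ m)

{-# OPTIONS --safe #-}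
-- Relabelling by x ↦ n x + 1 is injective, so it preserves properness and the
-- order of a labeling, and it makes every neighbourhood sum congruent to the
-- degree j modulo n, which is nonzero.  So proper labelings of order k become
-- proper open colorings with nonzero remainders of order k, while the latter
-- are proper labelings anyway; hence the two minima agree.
module Submission where

open import Defs
open import Data.Nat using (ℕ; NonZero)
open import Data.Nat.Divisibility using (_∣_)
open import Data.Integer as ℤ using (ℤ; +_; _+_; _*_)
open import Data.Integer.Properties using (*-cancelˡ-≡; *-identityʳ; +-0-abelianGroup)
open import Data.Integer.Divisibility.Signed as Signed using (∣ᵤ⇒∣; ∣⇒∣ᵤ; ∣m+n∣m⇒∣n; ∣m⇒∣m*n; ∣-refl)
open import Data.Integer.Tactic.RingSolver using (solve-∀)
open import Data.List using (List; []; _∷_; length; map)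
open import Data.Product using (_,_; map₂)
open import Algebra.Bundles using (AbelianGroup)
open import Algebra.Properties.Group (AbelianGroup.group +-0-abelianGroup) using (∙-cancelʳ)
open import Function.Base using (_∘_)
open import Function.Bundles using (_⇔_; mk⇔)
open import Function.Definitions using (Injective)
open import Relation.Nullary using (¬_)
open import Relation.Binary.PropositionalEquality using (_≡_; cong; subst; module ≡-Reasoning)

module _ (G : Graph) {φ : ℤ → ℤ} (φ-injective : Injective _≡_ _≡_ φ) where

  Proper-∘ : ∀ {ℓ} → Proper G ℓ → Proper G (φ ∘ ℓ)
  Proper-∘ proper u v u~v = proper u v u~v ∘ φ-injective

  HasOrder-∘ : ∀ {ℓ k} → HasOrder G ℓ k → HasOrder G (φ ∘ ℓ) k
  HasOrder-∘ (f , f-injective , ranged , hit) =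
    φ ∘ f , f-injective ∘ φ-injective ,
    map₂ (cong φ) ∘ ranged , map₂ (cong φ) ∘ hit

IsChi⇔IsChiN-byRelabelling : ∀ n G (φ : ℤ → ℤ) → Injective _≡_ _≡_ φ →
  (∀ ℓ → OpenNZ n G (φ ∘ ℓ)) → ∀ k → IsChi G k ⇔ IsChiN n G k
IsChi⇔IsChiN-byRelabelling n G φ φ-injective open-φ k = mk⇔ to from
  where
  to : IsChi G k → IsChiN n G k
  to ((ℓ , proper , order) , minimal) =
    (φ ∘ ℓ , Proper-∘ G φ-injective proper , open-φ ℓ , HasOrder-∘ G φ-injective order) ,
    λ m m<k ℓ′ proper′ _ → minimal m m<k ℓ′ proper′
  from : IsChiN n G k → IsChi G k
  from ((ℓ , proper , _ , order) , minimal) =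
    (ℓ , proper , order) ,
    λ m m<k ℓ′ proper′ order′ →
      minimal m m<k (φ ∘ ℓ′) (Proper-∘ G φ-injective proper′) (open-φ ℓ′)
        (HasOrder-∘ G φ-injective order′)

affine : ℤ → ℤ → ℤ → ℤ
affine a b x = a * x + b

affine-injective : ∀ a b .{{_ : ℤ.NonZero a}} → Injective _≡_ _≡_ (affine a b)
affine-injective a b {x} {y} = *-cancelˡ-≡ a x y ∘ ∙-cancelʳ b (a * x) (a * y)

sumℤ-map-affine : ∀ a b {A : Set} (ℓ : A → ℤ) (xs : List A) →
  sumℤ (map (affine a b ∘ ℓ) xs) ≡ a * sumℤ (map ℓ xs) + + length xs * b
sumℤ-map-affine a b ℓ [] = nil-identity a b
  where
  nil-identity : ∀ a b → + 0 ≡ a * + 0 + + 0 * b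
  nil-identity = solve-∀
sumℤ-map-affine a b ℓ (x ∷ xs) = begin
  affine a b (ℓ x) + sumℤ (map (affine a b ∘ ℓ) xs)
    ≡⟨ cong (λ t → affine a b (ℓ x) + t) (sumℤ-map-affine a b ℓ xs) ⟩
  affine a b (ℓ x) + (a * sumℤ (map ℓ xs) + + length xs * b)
    ≡⟨ cons-identity a b (ℓ x) (sumℤ (map ℓ xs)) (+ length xs) ⟩
  a * sumℤ (map ℓ (x ∷ xs)) + + length (x ∷ xs) * b ∎
  where
  open ≡-Reasoning
  cons-identity : ∀ a b y s m →
    a * y + b + (a * s + m * b) ≡ a * (y + s) + (+ 1 + m) * b
  cons-identity = solve-∀

OpenNZ-affine : ∀ n G → (∀ v → ¬ n ∣ length (nbrs G v)) →
  ∀ ℓ → OpenNZ n G (affine (+ n) (+ 1) ∘ ℓ)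
OpenNZ-affine n G n∤deg ℓ v n∣sum = n∤deg v (∣⇒∣ᵤ n∣deg)
  where
  N : List (V G)
  N = nbrs G v
  S : ℤ
  S = sumℤ (map ℓ N)
  sum≡ : sumℤ (map (affine (+ n) (+ 1) ∘ ℓ) N) ≡ + n * S + + length N
  sum≡ = begin
    sumℤ (map (affine (+ n) (+ 1) ∘ ℓ) N) ≡⟨ sumℤ-map-affine (+ n) (+ 1) ℓ N ⟩
    + n * S + + length N * + 1            ≡⟨ cong (λ t → + n * S + t) (*-identityʳ (+ length N)) ⟩
    + n * S + + length N                  ∎
    where open ≡-Reasoning
  -- Unsigned divisibility between +_ images is divisibility in ℕ by definition.
  n∣deg : + n Signed.∣ + length N
  n∣deg = ∣m+n∣m⇒∣n (subst (+ n Signed.∣_) sum≡ (∣ᵤ⇒∣ n∣sum)) (∣m⇒∣m*n S ∣-refl)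

theorem7p3 : (n j : ℕ) → .{{_ : NonZero n}} → .{{_ : NonZero j}} →
    (G : Graph) → Regular j G → ¬ (n ∣ j) →
    ∀ k → IsChi G k ⇔ IsChiN n G k
theorem7p3 n j G regular n∤j =
  IsChi⇔IsChiN-byRelabelling n G (affine (+ n) (+ 1)) (affine-injective (+ n) (+ 1))
    (OpenNZ-affine n G λ v → n∤j ∘ subst (n ∣_) (regular v))
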